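{- Let $q>2$ be even and let $S$ be a solid of $\mathrm{PG}(5,q)$ with hyperplane-orbit distribution $[1,a_{2r},a_{2i},a_3]$ that meets the Veronese surface $\mathcal V(\mathbb F_q)$ in exactly two points. Then $a_{2i}=0$ and $a_3>0$.
   Context: $\mathcal V(\mathbb F_q)$ is the image of $(u_0,u_1,u_2)\mapsto(u_0^2,u_0u_1,u_0u_2,u_1^2,u_1u_2,u_2^2)$ from $\mathrm{PG}(2,q)$ to $\mathrm{PG}(5,q)$. The conic $\mathcal Z(\sum_{i\le j}a_{ij}X_iX_j)$ of $\mathrm{PG}(2,q)$ corresponds to the hyperplane $a_{00}Y_0+a_{01}Y_1+a_{02}Y_2+a_{11}Y_3+a_{12}Y_4+a_{22}Y_5=0$. A hyperplane is of type $\mathcal H_1$, $\mathcal H_{2r}$, $\mathcal H_{2i}$, $\mathcal H_3$ according as its conic is a double line, a pair of distinct lines defined over $\mathbb F_q$, a pair of conjugate lines defined over $\mathbb F_{q^2}$ but not over $\mathbb F_q$, or a nonsingular conic. The hyperplane-orbit distribution of $S$ is $[a_1,a_{2r},a_{2i},a_3]$, $a_j$ being the number of hyperplanes of type $\mathcal H_j$ containing $S$. -}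

module Defs where

open import Level using (0ℓ)
open import Algebra.Bundles using (CommutativeRing)
open import Data.Nat using (ℕ; _<_)
open import Data.Nat.Divisibility using (_∣_)
open import Data.Fin using (Fin; zero; suc)
open import Data.List using (List; length)
open import Data.List.Relation.Unary.Any using (Any)
open import Data.List.Relation.Unary.AllPairs using (AllPairs)
open import Data.Product using (Σ; ∃; _×_; _,_; proj₁; proj₂)
open import Data.Sum using (_⊎_)
open import Relation.Nullary using (¬_)
open import Relation.Binary.PropositionalEquality using (_≡_)

record FiniteField : Set₁ where
  field
    cring    : CommutativeRing 0ℓ 0ℓ
  open CommutativeRing cring public
  field
    1≉0      : ¬ (1# ≈ 0#)
    inverse  : ∀ x → ¬ (x ≈ 0#) → ∃ λ y → x * y ≈ 1#
    elems    : List Carrier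
    complete : ∀ x → Any (x ≈_) elems
    distinct : AllPairs (λ x y → ¬ (x ≈ y)) elems

  order : ℕ
  order = length elems

module Geometry (𝔽 : FiniteField) where
  open FiniteField 𝔽 using (Carrier; _≈_; _+_; _*_; _-_; 0#; 1#)

  Vec : ℕ → Set
  Vec n = Fin n → Carrier

  NonZero : ∀ {n} → Vec n → Set
  NonZero v = ¬ (∀ i → v i ≈ 0#)

  -- v and w represent the same projective point
  _∼_ : ∀ {n} → Vec n → Vec n → Set
  v ∼ w = ∃ λ λ' → ¬ (λ' ≈ 0#) × (∀ i → w i ≈ λ' * v i)

  dot6 : Vec 6 → Vec 6 → Carrier
  dot6 a x = a zero * x zero + a (suc zero) * x (suc zero)
           + a (suc (suc zero)) * x (suc (suc zero))
           + a (suc (suc (suc zero))) * x (suc (suc (suc zero)))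
           + a (suc (suc (suc (suc zero)))) * x (suc (suc (suc (suc zero))))
           + a (suc (suc (suc (suc (suc zero))))) * x (suc (suc (suc (suc (suc zero)))))

  comb4 : (Fin 4 → Vec 6) → Vec 4 → Vec 6
  comb4 v c i = c zero * v zero i + c (suc zero) * v (suc zero) i
              + c (suc (suc zero)) * v (suc (suc zero)) i
              + c (suc (suc (suc zero))) * v (suc (suc (suc zero))) i

  LinIndep4 : (Fin 4 → Vec 6) → Set
  LinIndep4 v = ∀ c → (∀ i → comb4 v c i ≈ 0#) → ∀ k → c k ≈ 0#

  record Solid : Set where
    field
      basis : Fin 4 → Vec 6
      indep : LinIndep4 basis

  _∈S_ : Vec 6 → Solid → Set
  x ∈S S = ∃ λ c → ∀ i → x i ≈ comb4 (Solid.basis S) c i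

  Contains : Vec 6 → Solid → Set
  Contains a S = ∀ k → dot6 a (Solid.basis S k) ≈ 0#

  u0 u1 u2 : Vec 3 → Carrier
  u0 u = u zero
  u1 u = u (suc zero)
  u2 u = u (suc (suc zero))

  ver : Vec 3 → Vec 6
  ver u zero = u0 u * u0 u
  ver u (suc zero) = u0 u * u1 u
  ver u (suc (suc zero)) = u0 u * u2 u
  ver u (suc (suc (suc zero))) = u1 u * u1 u
  ver u (suc (suc (suc (suc zero)))) = u1 u * u2 u
  ver u (suc (suc (suc (suc (suc zero))))) = u2 u * u2 u

  MeetsVeroneseInTwoPoints : Solid → Set
  MeetsVeroneseInTwoPoints S =
    Σ (Vec 3) λ u → Σ (Vec 3) λ w →
      NonZero u × NonZero w × ver u ∈S S × ver w ∈S S × ¬ (ver u ∼ ver w)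
      × (∀ x → NonZero x → ver x ∈S S → ver x ∼ ver u ⊎ ver x ∼ ver w)

  -- The hyperplane a = (a00,a01,a02,a11,a12,a22) corresponds
  -- to the ternary quadratic form Σ_{i≤j} a_ij X_i X_j.

  module Prod {A : Set} (_⊕_ _⊗_ : A → A → A) where
    prodCoeffs : (Fin 3 → A) → (Fin 3 → A) → Fin 6 → A
    prodCoeffs L M zero = L zero ⊗ M zero
    prodCoeffs L M (suc zero) = (L zero ⊗ M (suc zero)) ⊕ (L (suc zero) ⊗ M zero)
    prodCoeffs L M (suc (suc zero)) = (L zero ⊗ M (suc (suc zero))) ⊕ (L (suc (suc zero)) ⊗ M zero)
    prodCoeffs L M (suc (suc (suc zero))) = L (suc zero) ⊗ M (suc zero)
    prodCoeffs L M (suc (suc (suc (suc zero)))) = (L (suc zero) ⊗ M (suc (suc zero))) ⊕ (L (suc (suc zero)) ⊗ M (suc zero))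
    prodCoeffs L M (suc (suc (suc (suc (suc zero))))) = L (suc (suc zero)) ⊗ M (suc (suc zero))

  open Prod _+_ _*_ renaming (prodCoeffs to prodF)

  IsDoubleLine : Vec 6 → Set
  IsDoubleLine a = ∃ λ c → ∃ λ (L : Vec 3) → ¬ (c ≈ 0#) × NonZero L
                   × (∀ i → a i ≈ c * prodF L L i)

  IsRealLinePair : Vec 6 → Set
  IsRealLinePair a = ∃ λ (L : Vec 3) → ∃ λ (M : Vec 3) →
                     NonZero L × NonZero M × ¬ (L ∼ M) × (∀ i → a i ≈ prodF L M i)

  -- The quadratic extension F_q[t]/(t² + β t + γ), for t² + β t + γ
  -- irreducible over F_q; it is (isomorphic to) F_{q²}.  Elements
  -- x + y t are pairs (x , y).
  Irreducible : Carrier → Carrier → Set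
  Irreducible β γ = ∀ x → ¬ (x * x + β * x + γ ≈ 0#)

  module Ext (β γ : Carrier) where
    E : Set
    E = Carrier × Carrier
    _⊕_ : E → E → E
    (x , y) ⊕ (x' , y') = (x + x' , y + y')
    -- t² = - β t - γ
    _⊗_ : E → E → E
    (x , y) ⊗ (x' , y') =
      (x * x' - γ * (y * y') , x * y' + y * x' - β * (y * y'))
    open Prod _⊕_ _⊗_ public renaming (prodCoeffs to prodE)

  SplitsOverFq² : Vec 6 → Set
  SplitsOverFq² a = ∃ λ β → ∃ λ γ → Irreducible β γ ×
    (let open Ext β γ in
     ∃ λ (L : Fin 3 → E) → ∃ λ (M : Fin 3 → E) →
       ∀ i → (a i ≈ proj₁ (prodE L M i))
           × (0# ≈ proj₂ (prodE L M i)))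

  IsImaginaryLinePair : Vec 6 → Set
  IsImaginaryLinePair a = SplitsOverFq² a × ¬ IsDoubleLine a × ¬ IsRealLinePair a

  IsNonsingularConic : Vec 6 → Set
  IsNonsingularConic a = ¬ SplitsOverFq² a

  -- Hyperplane-orbit distribution [a1, a2r, a2i, a3] of S, stated via
  -- the number of (projectively distinct) hyperplanes of each type
  -- containing S.

  A1≡1 : Solid → Set
  A1≡1 S = ∃ λ (a : Vec 6) → NonZero a × Contains a S × IsDoubleLine a
           × (∀ b → NonZero b → Contains b S → IsDoubleLine b → a ∼ b)

  A2i≡0 : Solid → Set
  A2i≡0 S = ∀ a → NonZero a → Contains a S → ¬ IsImaginaryLinePair a

  A3>0 : Solid → Set
  A3>0 S = ∃ λ (a : Vec 6) → NonZero a × Contains a S × IsNonsingularConic a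

module Submission where

-- Write quad c for the conic of the hyperplane c, so that the Veronese point of x lies on c iff
-- quad c x = 0.  In characteristic 2 the conic is degenerate iff it passes through its nucleus,
-- i.e. iff Δ c = 0, and Δ vanishes whenever quad c splits into linear forms over F_{q²}.
--
-- a2i = 0: the conic of a hyperplane through S vanishes at the two points u, w with
-- S ∩ V = {v(u), v(w)}.  If it splits over F_{q²} it is degenerate, and a degenerate conic with
-- two zeros contains a rational line (through u and w, or through one of them and the nucleus), so
-- it is a double line or a pair of rational lines.
--
-- a3 > 0: let a = s L² be the H1 hyperplane through S and b another hyperplane through S, so that
-- S = a ∩ b.  Then Δ (b + a) = Δ b + s (L · nucleus b)².  If L · nucleus b were 0, both conics
-- would vanish at u + w (L vanishes at u and w, so u ⨯ w is a multiple of L), giving a third point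
-- of S ∩ V.  Hence b or b + a is nonsingular.

open import Level using (0ℓ)
open import Algebra.Bundles using (CommutativeRing; RawRing)
open import Algebra.Solver.Ring.AlmostCommutativeRing
  using (fromCommutativeRing; _-Raw-AlmostCommutative⟶_)
import Algebra.Solver.Ring as RingSolver
import Algebra.Solver.Monoid as MonoidSolver
open import Data.Bool.Base using (Bool; true; false; if_then_else_)
import Data.Bool.Properties as Bool
open import Data.Empty using (⊥-elim)
open import Data.Fin.Base using (Fin; zero; suc; punchIn; punchOut)
open import Data.Fin.Patterns using (0F; 1F; 2F; 3F; 4F; 5F)
open import Data.Fin.Properties using (all?; ¬∀⟶∃¬; punchIn-punchOut)
import Data.Fin.Properties as Fin
open import Data.List.Relation.Unary.Any using (Any; here; there)
import Data.List.Relation.Unary.AllPairs as AllPairs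
open import Data.Maybe.Base using (Maybe; just; nothing)
open import Data.Nat.Base using (zero; suc; _<_; s≤s)
open import Data.Nat.Divisibility using (_∣_)
open import Data.Nat.Properties using (n<1+n; m<n⇒m<1+n)
open import Data.Product using (∃; _×_; _,_; proj₁; proj₂)
open import Data.Sum using (_⊎_; inj₁; inj₂)
open import Data.Vec.Functional using (_∷_; []; insertAt; removeAt)
open import Data.Vec.Functional.Properties using (insertAt-lookup; insertAt-punchIn)
open import Function.Base using (_∘_)
open import Relation.Nullary using (¬_; Dec; yes; no)
open import Relation.Binary.Definitions using (Decidable)
import Relation.Binary.PropositionalEquality as ≡

open import Defs

-- Normalising polynomials with coefficients in F₂ = (Bool, xor, ∧) decides the polynomial
-- identities of every commutative ring of characteristic 2.
module Char2Solver {c ℓ} (R : CommutativeRing c ℓ)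
  (1+1≈0 : CommutativeRing._≈_ R (CommutativeRing._+_ R (CommutativeRing.1# R) (CommutativeRing.1# R))
                                 (CommutativeRing.0# R)) where
  open CommutativeRing R
  open import Algebra.Properties.AbelianGroup +-abelianGroup using (inverseʳ-unique)
  open import Algebra.Properties.Ring ring using (-0#≈0#)

  private
    F₂ : RawRing 0ℓ 0ℓ
    F₂ = CommutativeRing.rawRing Bool.xor-∧-commutativeRing

    ⟦_⟧₂ : Bool → Carrier
    ⟦ b ⟧₂ = if b then 1# else 0#

    embed : F₂ -Raw-AlmostCommutative⟶ fromCommutativeRing R
    embed = record
      { ⟦_⟧    = ⟦_⟧₂
      ; +-homo = λ { false false → sym (+-identityˡ 0#) ; false true → sym (+-identityˡ 1#)
                   ; true false → sym (+-identityʳ 1#) ; true true → sym 1+1≈0 }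
      ; *-homo = λ { false false → sym (zeroˡ 0#) ; false true → sym (zeroˡ 1#)
                   ; true false → sym (zeroʳ 1#) ; true true → sym (*-identityˡ 1#) }
      ; -‿homo = λ { false → sym -0#≈0# ; true → inverseʳ-unique 1# 1# 1+1≈0 }
      ; 0-homo = refl
      ; 1-homo = refl
      }

    _≟₂_ : ∀ a b → Maybe (⟦ a ⟧₂ ≈ ⟦ b ⟧₂)
    a ≟₂ b with a Bool.≟ b
    ... | yes ≡.refl = just refl
    ... | no _ = nothing

  open RingSolver F₂ (fromCommutativeRing R) embed _≟₂_ public
    using (solve; _:=_; Polynomial; con; _:+_; _:*_; _:-_)

module LinearAlgebra (𝔽 : FiniteField) where
  open FiniteField 𝔽 hiding (zero)
  open Geometry 𝔽
  open import Algebra.Properties.Ring ring using (-‿distribˡ-*; -‿distribʳ-*)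
  open import Algebra.Properties.AbelianGroup +-abelianGroup using (inverseˡ-unique)
  open import Algebra.Properties.CommutativeSemigroup *-commutativeSemigroup using (x∙yz≈y∙xz)
  open import Algebra.Properties.Semiring.Sum semiring
    using (sum; sum-remove; ∑-comm; ∑-distrib-+; *-distribˡ-sum; sum-cong-≋; sum-replicate-zero)
  open import Data.List.Membership.Setoid.Properties using (∈-resp-≈)
  open import Data.List.Relation.Unary.Unique.Setoid setoid using (Unique)
  open import Data.List.Relation.Unary.Unique.Setoid.Properties using (Unique[x∷xs]⇒x∉xs)
  open import Relation.Binary.Reasoning.Setoid setoid

  _≟_ : Decidable _≈_
  x ≟ y = compare distinct (complete x) (complete y)
    where
    compare : ∀ {xs} → Unique xs → Any (x ≈_) xs → Any (y ≈_) xs → Dec (x ≈ y)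
    compare _ (here x≈e) (here y≈e) = yes (trans x≈e (sym y≈e))
    compare u (here x≈e) (there y∈) =
      no λ x≈y → Unique[x∷xs]⇒x∉xs setoid u (∈-resp-≈ setoid (trans (sym x≈y) x≈e) y∈)
    compare u (there x∈) (here y≈e) =
      no λ x≈y → Unique[x∷xs]⇒x∉xs setoid u (∈-resp-≈ setoid (trans x≈y y≈e) x∈)
    compare (_ AllPairs.∷ u) (there x∈) (there y∈) = compare u x∈ y∈

  all-zero? : ∀ {n} (v : Vec n) → Dec (∀ i → v i ≈ 0#)
  all-zero? v = all? (λ i → v i ≟ 0#)

  nonzero-entry : ∀ {n} {v : Vec n} → NonZero v → ∃ λ i → ¬ v i ≈ 0#
  nonzero-entry {n} {v} = ¬∀⟶∃¬ n (λ i → v i ≈ 0#) (λ i → v i ≟ 0#)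

  nonzero-entry-off : ∀ {n} {v : Vec (suc n)} j → NonZero v → v j ≈ 0# → ∃ λ k → ¬ v (punchIn j k) ≈ 0#
  nonzero-entry-off {v = v} j v≉0 vⱼ≈0 with nonzero-entry v≉0
  ... | k , vₖ≉0 = punchOut j≢k , ≡.subst (λ i → ¬ v i ≈ 0#) (≡.sym (punchIn-punchOut j≢k)) vₖ≉0
    where
    j≢k : j ≡.≢ k
    j≢k j≡k = vₖ≉0 (≡.subst (λ i → v i ≈ 0#) j≡k vⱼ≈0)

  inv : ∀ {x} → ¬ x ≈ 0# → Carrier
  inv {x} x≉0 = proj₁ (inverse x x≉0)

  x*inv≈1 : ∀ {x} (x≉0 : ¬ x ≈ 0#) → x * inv x≉0 ≈ 1#
  x*inv≈1 {x} x≉0 = proj₂ (inverse x x≉0)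

  inv-cancelˡ : ∀ {x} (x≉0 : ¬ x ≈ 0#) y → inv x≉0 * (x * y) ≈ y
  inv-cancelˡ {x} x≉0 y = begin
    inv x≉0 * (x * y)  ≈⟨ *-assoc _ x y ⟨
    inv x≉0 * x * y    ≈⟨ *-congʳ (trans (*-comm _ x) (x*inv≈1 x≉0)) ⟩
    1# * y             ≈⟨ *-identityˡ y ⟩
    y                  ∎

  x*y≈0⇒y≈0 : ∀ {x y} → ¬ x ≈ 0# → x * y ≈ 0# → y ≈ 0#
  x*y≈0⇒y≈0 {x} {y} x≉0 xy≈0 = begin
    y                  ≈⟨ inv-cancelˡ x≉0 y ⟨
    inv x≉0 * (x * y)  ≈⟨ *-congˡ xy≈0 ⟩
    inv x≉0 * 0#       ≈⟨ zeroʳ _ ⟩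
    0#                 ∎

  x*y≉0 : ∀ {x y} → ¬ x ≈ 0# → ¬ y ≈ 0# → ¬ x * y ≈ 0#
  x*y≉0 x≉0 y≉0 = y≉0 ∘ x*y≈0⇒y≈0 x≉0

  y≈0⇒x*y≈0 : ∀ x {y} → y ≈ 0# → x * y ≈ 0#
  y≈0⇒x*y≈0 x y≈0 = trans (*-congˡ y≈0) (zeroʳ x)

  x≈0⇒x*y≈0 : ∀ {x} y → x ≈ 0# → x * y ≈ 0#
  x≈0⇒x*y≈0 y x≈0 = trans (*-congʳ x≈0) (zeroˡ y)

  x*x≈0⇒x≈0 : ∀ {x} → x * x ≈ 0# → x ≈ 0#
  x*x≈0⇒x≈0 {x} xx≈0 with x ≟ 0#
  ... | yes x≈0 = x≈0
  ... | no x≉0 = x*y≈0⇒y≈0 x≉0 xx≈0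

  ⟨_,_⟩ : ∀ {n} → Vec n → Vec n → Carrier
  ⟨ x , y ⟩ = sum (λ i → x i * y i)

  ⟨⟩-congʳ : ∀ {n} (x : Vec n) {y y' : Vec n} → (∀ i → y i ≈ y' i) → ⟨ x , y ⟩ ≈ ⟨ x , y' ⟩
  ⟨⟩-congʳ x y≈y' = sum-cong-≋ (λ i → *-congˡ (y≈y' i))

  ⟨⟩-comm : ∀ {n} (x y : Vec n) → ⟨ x , y ⟩ ≈ ⟨ y , x ⟩
  ⟨⟩-comm x y = sum-cong-≋ (λ i → *-comm (x i) (y i))

  ⟨⟩-zeroʳ : ∀ {n} (x : Vec n) {y : Vec n} → (∀ i → y i ≈ 0#) → ⟨ x , y ⟩ ≈ 0#
  ⟨⟩-zeroʳ {n} x y≈0 = trans (sum-cong-≋ (λ i → y≈0⇒x*y≈0 (x i) (y≈0 i))) (sum-replicate-zero n)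

  ⟨⟩-insertAt : ∀ {n} (x : Vec (suc n)) (y : Vec n) j v →
                ⟨ x , insertAt y j v ⟩ ≈ x j * v + ⟨ removeAt x j , y ⟩
  ⟨⟩-insertAt x y j v = trans (sum-remove {i = j} (λ i → x i * insertAt y j v i))
    (+-cong (*-congˡ (reflexive (insertAt-lookup y j v)))
            (sum-cong-≋ (λ i → *-congˡ (reflexive (insertAt-punchIn y j v i)))))

  ⟨⟩-+ˡ : ∀ {n} (a b y : Vec n) → ⟨ (λ i → a i + b i) , y ⟩ ≈ ⟨ a , y ⟩ + ⟨ b , y ⟩
  ⟨⟩-+ˡ a b y =
    trans (sum-cong-≋ (λ i → distribʳ (y i) (a i) (b i))) (∑-distrib-+ (λ i → a i * y i) (λ i → b i * y i))

  ⟨⟩-scaleˡ : ∀ {n} t (x y : Vec n) → ⟨ (λ i → t * x i) , y ⟩ ≈ t * ⟨ x , y ⟩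
  ⟨⟩-scaleˡ t x y =
    trans (sum-cong-≋ (λ i → *-assoc t (x i) (y i))) (sym (*-distribˡ-sum t (λ i → x i * y i)))

  ⟨⟩-linearˡ : ∀ {n} (a b y : Vec n) t → ⟨ (λ i → a i + t * b i) , y ⟩ ≈ ⟨ a , y ⟩ + t * ⟨ b , y ⟩
  ⟨⟩-linearˡ a b y t = trans (⟨⟩-+ˡ a (λ i → t * b i) y) (+-congˡ (⟨⟩-scaleˡ t b y))

  ⟨⟩-transpose : ∀ {m n} (a : Vec n) (c : Vec m) (M : Fin m → Vec n) →
                 ⟨ a , (λ i → ⟨ c , (λ k → M k i) ⟩) ⟩ ≈ ⟨ c , (λ k → ⟨ a , M k ⟩) ⟩
  ⟨⟩-transpose a c M = begin
    sum (λ i → a i * sum (λ k → c k * M k i))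
      ≈⟨ sum-cong-≋ (λ i → *-distribˡ-sum (a i) (λ k → c k * M k i)) ⟩
    sum (λ i → sum (λ k → a i * (c k * M k i)))
      ≈⟨ ∑-comm (λ i k → a i * (c k * M k i)) ⟩
    sum (λ k → sum (λ i → a i * (c k * M k i)))
      ≈⟨ sum-cong-≋ (λ k → sum-cong-≋ (λ i → x∙yz≈y∙xz (a i) (c k) (M k i))) ⟩
    sum (λ k → sum (λ i → c k * (a i * M k i)))
      ≈⟨ sum-cong-≋ (λ k → *-distribˡ-sum (c k) (λ i → a i * M k i)) ⟨
    sum (λ k → c k * ⟨ a , M k ⟩)
      ∎

  ⟨⟩-two-entries : ∀ {n} (h y : Vec (suc (suc n))) j k →
                   (∀ r → y (punchIn j (punchIn k r)) ≈ 0#) →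
                   ⟨ h , y ⟩ ≈ h j * y j + h (punchIn j k) * y (punchIn j k)
  ⟨⟩-two-entries h y j k y-rest≈0 = begin
    ⟨ h , y ⟩                                               ≈⟨ sum-remove {i = j} (λ i → h i * y i) ⟩
    h j * y j + ⟨ removeAt h j , removeAt y j ⟩
      ≈⟨ +-congˡ (sum-remove {i = k} (removeAt (λ i → h i * y i) j)) ⟩
    h j * y j + (h (punchIn j k) * y (punchIn j k) + rest)  ≈⟨ +-congˡ (+-congˡ (⟨⟩-zeroʳ _ y-rest≈0)) ⟩
    h j * y j + (h (punchIn j k) * y (punchIn j k) + 0#)    ≈⟨ +-congˡ (+-identityʳ _) ⟩
    h j * y j + h (punchIn j k) * y (punchIn j k)           ∎
    where
    rest : Carrier
    rest = ⟨ removeAt (removeAt h j) k , removeAt (removeAt y j) k ⟩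

  punchIn-cases : ∀ {n} (j : Fin (suc n)) l → l ≡.≡ j ⊎ ∃ λ l' → l ≡.≡ punchIn j l'
  punchIn-cases j l with j Fin.≟ l
  ... | yes j≡l = inj₁ (≡.sym j≡l)
  ... | no j≢l = inj₂ (punchOut j≢l , ≡.sym (punchIn-punchOut j≢l))

  vanishing-from-entries : ∀ {n} {y : Vec (suc (suc n))} j k → y j ≈ 0# → y (punchIn j k) ≈ 0# →
                           (∀ r → y (punchIn j (punchIn k r)) ≈ 0#) → ∀ l → y l ≈ 0#
  vanishing-from-entries j k yⱼ≈0 yₖ≈0 y-rest≈0 l with punchIn-cases j l
  ... | inj₁ ≡.refl = yⱼ≈0
  ... | inj₂ (l' , ≡.refl) with punchIn-cases k l'
  ...   | inj₁ ≡.refl = yₖ≈0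
  ...   | inj₂ (r , ≡.refl) = y-rest≈0 r

  insertAt-nonzero : ∀ {n} {y : Vec n} j v → NonZero y → NonZero (insertAt y j v)
  insertAt-nonzero {y = y} j v y≉0 insertAt≈0 =
    y≉0 (λ i → trans (sym (reflexive (insertAt-punchIn y j v i))) (insertAt≈0 (punchIn j i)))

  private
    module Elimination {n} (p : Vec (suc n)) (j : Fin (suc n)) (pⱼ≉0 : ¬ p j ≈ 0#) where
      extend : Vec n → Vec (suc n)
      extend y = insertAt y j (- (inv pⱼ≉0 * ⟨ removeAt p j , y ⟩))

      reduce : Vec (suc n) → Vec n
      reduce h i = removeAt h j i + - (h j * inv pⱼ≉0) * removeAt p j i

      pivot-row : ∀ y → ⟨ p , extend y ⟩ ≈ 0#
      pivot-row y = begin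
        ⟨ p , extend y ⟩              ≈⟨ ⟨⟩-insertAt p y j _ ⟩
        p j * - (inv pⱼ≉0 * S) + S    ≈⟨ +-congʳ (-‿distribʳ-* (p j) _) ⟨
        - (p j * (inv pⱼ≉0 * S)) + S  ≈⟨ +-congʳ (-‿cong (*-assoc (p j) _ S)) ⟨
        - (p j * inv pⱼ≉0 * S) + S    ≈⟨ +-congʳ (-‿cong (trans (*-congʳ (x*inv≈1 pⱼ≉0)) (*-identityˡ S))) ⟩
        - S + S                       ≈⟨ -‿inverseˡ S ⟩
        0#                            ∎
        where
        S : Carrier
        S = ⟨ removeAt p j , y ⟩

      other-row : ∀ h y → ⟨ h , extend y ⟩ ≈ ⟨ reduce h , y ⟩
      other-row h y = begin
        ⟨ h , extend y ⟩                                 ≈⟨ ⟨⟩-insertAt h y j _ ⟩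
        h j * - (inv pⱼ≉0 * S) + ⟨ removeAt h j , y ⟩    ≈⟨ +-comm _ _ ⟩
        ⟨ removeAt h j , y ⟩ + h j * - (inv pⱼ≉0 * S)    ≈⟨ +-congˡ (-‿distribʳ-* (h j) _) ⟨
        ⟨ removeAt h j , y ⟩ + - (h j * (inv pⱼ≉0 * S))  ≈⟨ +-congˡ (-‿cong (*-assoc (h j) _ S)) ⟨
        ⟨ removeAt h j , y ⟩ + - (h j * inv pⱼ≉0 * S)    ≈⟨ +-congˡ (-‿distribˡ-* _ S) ⟩
        ⟨ removeAt h j , y ⟩ + - (h j * inv pⱼ≉0) * S    ≈⟨ ⟨⟩-linearˡ (removeAt h j) (removeAt p j) y _ ⟨
        ⟨ reduce h , y ⟩                                 ∎
        where
        S : Carrier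
        S = ⟨ removeAt p j , y ⟩

  nontrivial-solution : ∀ {m n} → m < n → (f : Fin m → Vec n) →
                        ∃ λ x → NonZero x × ∀ r → ⟨ f r , x ⟩ ≈ 0#
  nontrivial-solution {zero} {suc n} _ f = (1# ∷ λ _ → 0#) , (λ e≈0 → 1≉0 (e≈0 zero)) , λ ()
  nontrivial-solution {suc m} {suc n} (s≤s m<n) f with all-zero? (f zero)
  ... | yes f₀≈0 =
    let x , x≉0 , fx≈0 = nontrivial-solution (m<n⇒m<1+n m<n) (f ∘ suc)
    in x , x≉0 , λ { zero → trans (⟨⟩-comm (f zero) x) (⟨⟩-zeroʳ x f₀≈0) ; (suc r) → fx≈0 r }
  ... | no f₀≉0 =
    let j , pⱼ≉0 = nonzero-entry f₀≉0
        open Elimination (f zero) j pⱼ≉0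
        y , y≉0 , y-solves = nontrivial-solution m<n (reduce ∘ f ∘ suc)
    in extend y , insertAt-nonzero j _ y≉0 ,
       λ { zero → pivot-row y ; (suc r) → trans (other-row (f (suc r)) y) (y-solves r) }

  dot6≈⟨⟩ : ∀ a z → dot6 a z ≈ ⟨ a , z ⟩
  dot6≈⟨⟩ a z = solve 6 (λ t₀ t₁ t₂ t₃ t₄ t₅ →
    ((((t₀ ⊕ t₁) ⊕ t₂) ⊕ t₃) ⊕ t₄) ⊕ t₅ ⊜ t₀ ⊕ t₁ ⊕ t₂ ⊕ t₃ ⊕ t₄ ⊕ t₅ ⊕ id) refl
    (a 0F * z 0F) (a 1F * z 1F) (a 2F * z 2F) (a 3F * z 3F) (a 4F * z 4F) (a 5F * z 5F)
    where open MonoidSolver +-monoid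

  comb4≈⟨⟩ : ∀ v c i → comb4 v c i ≈ ⟨ c , (λ k → v k i) ⟩
  comb4≈⟨⟩ v c i = solve 4 (λ t₀ t₁ t₂ t₃ → ((t₀ ⊕ t₁) ⊕ t₂) ⊕ t₃ ⊜ t₀ ⊕ t₁ ⊕ t₂ ⊕ t₃ ⊕ id) refl
    (c 0F * v 0F i) (c 1F * v 1F i) (c 2F * v 2F i) (c 3F * v 3F i)
    where open MonoidSolver +-monoid

  module _ (S : Solid) where
    open Solid S

    ⟨⟩-basis : ∀ a → Contains a S → ∀ k → ⟨ a , basis k ⟩ ≈ 0#
    ⟨⟩-basis a a⊇S k = trans (sym (dot6≈⟨⟩ a (basis k))) (a⊇S k)

    ∈S⇒on-hyperplane : ∀ a {x} → Contains a S → x ∈S S → dot6 a x ≈ 0#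
    ∈S⇒on-hyperplane a {x} a⊇S (c , x≈comb) = begin
      dot6 a x                                   ≈⟨ dot6≈⟨⟩ a x ⟩
      ⟨ a , x ⟩                                   ≈⟨ ⟨⟩-congʳ a (λ i → trans (x≈comb i) (comb4≈⟨⟩ basis c i)) ⟩
      ⟨ a , (λ i → ⟨ c , (λ k → basis k i) ⟩) ⟩   ≈⟨ ⟨⟩-transpose a c basis ⟩
      ⟨ c , (λ k → ⟨ a , basis k ⟩) ⟩             ≈⟨ ⟨⟩-zeroʳ c (⟨⟩-basis a a⊇S) ⟩
      0#                                         ∎

    contains-+ : ∀ a b → Contains a S → Contains b S → Contains (λ i → a i + b i) S
    contains-+ a b a⊇S b⊇S k = begin
      dot6 (λ i → a i + b i) (basis k)  ≈⟨ dot6≈⟨⟩ (λ i → a i + b i) (basis k) ⟩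
      ⟨ (λ i → a i + b i) , basis k ⟩    ≈⟨ ⟨⟩-+ˡ a b (basis k) ⟩
      ⟨ a , basis k ⟩ + ⟨ b , basis k ⟩   ≈⟨ +-cong (⟨⟩-basis a a⊇S k) (⟨⟩-basis b b⊇S k) ⟩
      0# + 0#                           ≈⟨ +-identityʳ 0# ⟩
      0#                                ∎

    hyperplane-through-solid : ∀ j → ∃ λ b → NonZero b × b j ≈ 0# × Contains b S
    hyperplane-through-solid j with nontrivial-solution (n<1+n 4) (λ k → removeAt (basis k) j)
    ... | y , y≉0 , y-solves =
      insertAt y j 0# , insertAt-nonzero j 0# y≉0 , reflexive (insertAt-lookup y j 0#) , b⊇S
      where
      b⊇S : Contains (insertAt y j 0#) S
      b⊇S k = begin
        dot6 (insertAt y j 0#) (basis k)               ≈⟨ dot6≈⟨⟩ (insertAt y j 0#) (basis k) ⟩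
        ⟨ insertAt y j 0# , basis k ⟩                   ≈⟨ ⟨⟩-comm (insertAt y j 0#) (basis k) ⟩
        ⟨ basis k , insertAt y j 0# ⟩                   ≈⟨ ⟨⟩-insertAt (basis k) y j 0# ⟩
        basis k j * 0# + ⟨ removeAt (basis k) j , y ⟩   ≈⟨ +-cong (zeroʳ _) (y-solves k) ⟩
        0# + 0#                                        ≈⟨ +-identityˡ 0# ⟩
        0#                                             ∎

    dependent⇒∈S : ∀ {z} (c : Vec 5) → NonZero c →
                   (∀ l → c 0F * z l + ⟨ c ∘ suc , (λ k → basis k l) ⟩ ≈ 0#) → z ∈S S
    dependent⇒∈S {z} c c≉0 dependent with c 0F ≟ 0#
    ... | yes c₀≈0 = ⊥-elim (c≉0 λ { zero → c₀≈0 ; (suc k) → indep (c ∘ suc) comb≈0 k })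
      where
      comb≈0 : ∀ l → comb4 basis (c ∘ suc) l ≈ 0#
      comb≈0 l = begin
        comb4 basis (c ∘ suc) l                       ≈⟨ comb4≈⟨⟩ basis (c ∘ suc) l ⟩
        ⟨ c ∘ suc , (λ k → basis k l) ⟩               ≈⟨ +-identityˡ _ ⟨
        0# + ⟨ c ∘ suc , (λ k → basis k l) ⟩          ≈⟨ +-congʳ (x≈0⇒x*y≈0 (z l) c₀≈0) ⟨
        c 0F * z l + ⟨ c ∘ suc , (λ k → basis k l) ⟩  ≈⟨ dependent l ⟩
        0#                                            ∎
    ... | no c₀≉0 = (λ k → - inv c₀≉0 * c (suc k)) , λ l → begin
      z l                                                      ≈⟨ inv-cancelˡ c₀≉0 (z l) ⟨
      inv c₀≉0 * (c 0F * z l)                                   ≈⟨ *-congˡ (inverseˡ-unique _ _ (dependent l)) ⟩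
      inv c₀≉0 * - ⟨ c ∘ suc , (λ k → basis k l) ⟩              ≈⟨ -‿distribʳ-* _ _ ⟨
      - (inv c₀≉0 * ⟨ c ∘ suc , (λ k → basis k l) ⟩)            ≈⟨ -‿distribˡ-* _ _ ⟩
      - inv c₀≉0 * ⟨ c ∘ suc , (λ k → basis k l) ⟩
        ≈⟨ ⟨⟩-scaleˡ (- inv c₀≉0) (c ∘ suc) (λ k → basis k l) ⟨
      ⟨ (λ k → - inv c₀≉0 * c (suc k)) , (λ k → basis k l) ⟩
        ≈⟨ comb4≈⟨⟩ basis (λ k → - inv c₀≉0 * c (suc k)) l ⟨
      comb4 basis (λ k → - inv c₀≉0 * c (suc k)) l              ∎

    -- Some nonzero combination Y of the basis and z vanishes at the four coordinates other than j
    -- and the pivot punchIn j k of b; then a · Y = b · Y = 0 forces Y = 0, so z depends on the basis.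
    hyperplane-intersection⊆solid :
      ∀ a b {z j} → Contains a S → Contains b S → ¬ a j ≈ 0# → b j ≈ 0# → NonZero b →
      dot6 a z ≈ 0# → dot6 b z ≈ 0# → z ∈S S
    hyperplane-intersection⊆solid a b {z} {j} a⊇S b⊇S aⱼ≉0 bⱼ≈0 b≉0 az≈0 bz≈0
      with nonzero-entry-off j b≉0 bⱼ≈0
    ... | k , bₖ≉0 with nontrivial-solution (n<1+n 4) (λ r m → (z ∷ basis) m (punchIn j (punchIn k r)))
    ... | c , c≉0 , c-solves = dependent⇒∈S c c≉0 (vanishing-from-entries j k Yⱼ≈0 Yₖ≈0 Y-rest≈0)
      where
      Y : Vec 6
      Y l = ⟨ c , (λ m → (z ∷ basis) m l) ⟩

      Y-rest≈0 : ∀ r → Y (punchIn j (punchIn k r)) ≈ 0#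
      Y-rest≈0 r = trans (⟨⟩-comm c (λ m → (z ∷ basis) m (punchIn j (punchIn k r)))) (c-solves r)

      ⟨h,Y⟩≈0 : ∀ h → Contains h S → dot6 h z ≈ 0# → ⟨ h , Y ⟩ ≈ 0#
      ⟨h,Y⟩≈0 h h⊇S hz≈0 = trans (⟨⟩-transpose h c (z ∷ basis)) (⟨⟩-zeroʳ c ⟨h,W⟩≈0)
        where
        ⟨h,W⟩≈0 : ∀ m → ⟨ h , (z ∷ basis) m ⟩ ≈ 0#
        ⟨h,W⟩≈0 zero = trans (sym (dot6≈⟨⟩ h z)) hz≈0
        ⟨h,W⟩≈0 (suc m) = ⟨⟩-basis h h⊇S m

      Yₖ≈0 : Y (punchIn j k) ≈ 0#
      Yₖ≈0 = x*y≈0⇒y≈0 bₖ≉0 (begin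
        b (punchIn j k) * Y (punchIn j k)              ≈⟨ +-identityˡ _ ⟨
        0# + b (punchIn j k) * Y (punchIn j k)         ≈⟨ +-congʳ (x≈0⇒x*y≈0 (Y j) bⱼ≈0) ⟨
        b j * Y j + b (punchIn j k) * Y (punchIn j k)  ≈⟨ ⟨⟩-two-entries b Y j k Y-rest≈0 ⟨
        ⟨ b , Y ⟩                                       ≈⟨ ⟨h,Y⟩≈0 b b⊇S bz≈0 ⟩
        0#                                             ∎)

      Yⱼ≈0 : Y j ≈ 0#
      Yⱼ≈0 = x*y≈0⇒y≈0 aⱼ≉0 (begin
        a j * Y j                                      ≈⟨ +-identityʳ _ ⟨
        a j * Y j + 0#                                 ≈⟨ +-congˡ (y≈0⇒x*y≈0 (a (punchIn j k)) Yₖ≈0) ⟨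
        a j * Y j + a (punchIn j k) * Y (punchIn j k)  ≈⟨ ⟨⟩-two-entries a Y j k Y-rest≈0 ⟨
        ⟨ a , Y ⟩                                       ≈⟨ ⟨h,Y⟩≈0 a a⊇S az≈0 ⟩
        0#                                             ∎)

module Conics (𝔽 : FiniteField) where
  open Geometry 𝔽 using (module Prod)

  -- Shared by the field, its quadratic extension and the solver's polynomial syntax, so that
  -- solver goals are stated with the very definitions they are about.
  module Forms {A : Set} (add mul : A → A → A) where
    infixl 6 _+_ _+ᵥ_
    infixl 7 _*_
    infixr 7 _•_
    infix 8 _·_
    infix 9 _⨯_
    private
      _+_ _*_ : A → A → A
      _+_ = add
      _*_ = mul

    open Prod _+_ _*_ public renaming (prodCoeffs to _⊗_)

    _+ᵥ_ : ∀ {n} → (Fin n → A) → (Fin n → A) → Fin n → A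
    (x +ᵥ y) i = x i + y i

    _•_ : ∀ {n} → A → (Fin n → A) → Fin n → A
    (s • x) i = s * x i

    _·_ : (Fin 3 → A) → (Fin 3 → A) → A
    x · y = x 0F * y 0F + x 1F * y 1F + x 2F * y 2F

    -- The cross product up to signs, which do not matter in characteristic 2.
    _⨯_ : (Fin 3 → A) → (Fin 3 → A) → Fin 3 → A
    (x ⨯ y) 0F = x 1F * y 2F + x 2F * y 1F
    (x ⨯ y) 1F = x 2F * y 0F + x 0F * y 2F
    (x ⨯ y) 2F = x 0F * y 1F + x 1F * y 0F

    -- Over the field, quad c x unfolds to dot6 c (ver x).
    quad : (Fin 6 → A) → (Fin 3 → A) → A
    quad c x = c 0F * (x 0F * x 0F) + c 1F * (x 0F * x 1F) + c 2F * (x 0F * x 2F)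
             + c 3F * (x 1F * x 1F) + c 4F * (x 1F * x 2F) + c 5F * (x 2F * x 2F)

    -- In characteristic 2 the polar form of quad c is (x , y) ↦ nucleus c · (x ⨯ y), and the
    -- conic is degenerate iff it passes through its nucleus, i.e. iff Δ c = 0.
    nucleus : (Fin 6 → A) → Fin 3 → A
    nucleus c 0F = c 4F
    nucleus c 1F = c 2F
    nucleus c 2F = c 1F

    polar : (Fin 6 → A) → (Fin 3 → A) → (Fin 3 → A) → A
    polar c x y = nucleus c · (x ⨯ y)

    Δ : (Fin 6 → A) → A
    Δ c = quad c (nucleus c)

  module FormsCong {A : Set} (_≈_ : A → A → Set) (add mul : A → A → A)
    (+-cong : ∀ {x x' y y'} → x ≈ x' → y ≈ y' → add x y ≈ add x' y')
    (*-cong : ∀ {x x' y y'} → x ≈ x' → y ≈ y' → mul x y ≈ mul x' y') where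
    open Forms add mul

    quad-cong : ∀ {c c' x x'} → (∀ i → c i ≈ c' i) → (∀ i → x i ≈ x' i) → quad c x ≈ quad c' x'
    quad-cong {c} {c'} {x} {x'} c≈c' x≈x' =
      +-cong (+-cong (+-cong (+-cong (+-cong (term 0F 0F 0F) (term 1F 0F 1F)) (term 2F 0F 2F))
        (term 3F 1F 1F)) (term 4F 1F 2F)) (term 5F 2F 2F)
      where
      term : ∀ k i j → mul (c k) (mul (x i) (x j)) ≈ mul (c' k) (mul (x' i) (x' j))
      term k i j = *-cong (c≈c' k) (*-cong (x≈x' i) (x≈x' j))

    Δ-cong : ∀ {c c'} → (∀ i → c i ≈ c' i) → Δ c ≈ Δ c'
    Δ-cong {c} {c'} c≈c' =
      quad-cong {x = nucleus c} {nucleus c'} c≈c' λ { 0F → c≈c' 4F ; 1F → c≈c' 2F ; 2F → c≈c' 1F }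

    ·-cong : ∀ {x x' y y'} → (∀ i → x i ≈ x' i) → (∀ i → y i ≈ y' i) → (x · y) ≈ (x' · y')
    ·-cong x≈x' y≈y' = +-cong (+-cong (*-cong (x≈x' 0F) (y≈y' 0F)) (*-cong (x≈x' 1F) (y≈y' 1F)))
                              (*-cong (x≈x' 2F) (y≈y' 2F))

    ⨯-cong : ∀ {x x' y y'} → (∀ i → x i ≈ x' i) → (∀ i → y i ≈ y' i) → ∀ k → (x ⨯ y) k ≈ (x' ⨯ y') k
    ⨯-cong x≈x' y≈y' 0F = +-cong (*-cong (x≈x' 1F) (y≈y' 2F)) (*-cong (x≈x' 2F) (y≈y' 1F))
    ⨯-cong x≈x' y≈y' 1F = +-cong (*-cong (x≈x' 2F) (y≈y' 0F)) (*-cong (x≈x' 0F) (y≈y' 2F))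
    ⨯-cong x≈x' y≈y' 2F = +-cong (*-cong (x≈x' 0F) (y≈y' 1F)) (*-cong (x≈x' 1F) (y≈y' 0F))

  open FiniteField 𝔽 hiding (zero)
  open Geometry 𝔽 hiding (module Prod)
  open LinearAlgebra 𝔽
  open Forms _+_ _*_
  open FormsCong _≈_ _+_ _*_ +-cong *-cong
  open import Algebra.Properties.CommutativeSemigroup *-commutativeSemigroup using (x∙yz≈y∙xz)
  open import Relation.Binary.Reasoning.Setoid setoid

  ⊗-congʳ : ∀ l {m m'} → (∀ i → m i ≈ m' i) → ∀ k → (l ⊗ m) k ≈ (l ⊗ m') k
  ⊗-congʳ l m≈m' 0F = *-congˡ (m≈m' 0F)
  ⊗-congʳ l m≈m' 1F = +-cong (*-congˡ (m≈m' 1F)) (*-congˡ (m≈m' 0F))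
  ⊗-congʳ l m≈m' 2F = +-cong (*-congˡ (m≈m' 2F)) (*-congˡ (m≈m' 0F))
  ⊗-congʳ l m≈m' 3F = *-congˡ (m≈m' 1F)
  ⊗-congʳ l m≈m' 4F = +-cong (*-congˡ (m≈m' 2F)) (*-congˡ (m≈m' 1F))
  ⊗-congʳ l m≈m' 5F = *-congˡ (m≈m' 2F)

  ⊗-•ʳ : ∀ s l m k → (l ⊗ (s • m)) k ≈ s * (l ⊗ m) k
  ⊗-•ʳ s l m 0F = x∙yz≈y∙xz (l 0F) s (m 0F)
  ⊗-•ʳ s l m 1F =
    trans (+-cong (x∙yz≈y∙xz (l 0F) s (m 1F)) (x∙yz≈y∙xz (l 1F) s (m 0F))) (sym (distribˡ s _ _))
  ⊗-•ʳ s l m 2F =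
    trans (+-cong (x∙yz≈y∙xz (l 0F) s (m 2F)) (x∙yz≈y∙xz (l 2F) s (m 0F))) (sym (distribˡ s _ _))
  ⊗-•ʳ s l m 3F = x∙yz≈y∙xz (l 1F) s (m 1F)
  ⊗-•ʳ s l m 4F =
    trans (+-cong (x∙yz≈y∙xz (l 1F) s (m 2F)) (x∙yz≈y∙xz (l 2F) s (m 1F))) (sym (distribˡ s _ _))
  ⊗-•ʳ s l m 5F = x∙yz≈y∙xz (l 2F) s (m 2F)

  unit : Fin 3 → Vec 3
  unit 0F = 1# ∷ 0# ∷ 0# ∷ []
  unit 1F = 0# ∷ 1# ∷ 0# ∷ []
  unit 2F = 0# ∷ 0# ∷ 1# ∷ []

  coefficients : (Vec 3 → Carrier) → Vec 6
  coefficients q 0F = q (unit 0F)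
  coefficients q 1F = q (1# ∷ 1# ∷ 0# ∷ []) - q (unit 0F) - q (unit 1F)
  coefficients q 2F = q (1# ∷ 0# ∷ 1# ∷ []) - q (unit 0F) - q (unit 2F)
  coefficients q 3F = q (unit 1F)
  coefficients q 4F = q (0# ∷ 1# ∷ 1# ∷ []) - q (unit 1F) - q (unit 2F)
  coefficients q 5F = q (unit 2F)

  coefficients-cong : ∀ {q q'} → (∀ x → q x ≈ q' x) → ∀ i → coefficients q i ≈ coefficients q' i
  coefficients-cong q≈q' 0F = q≈q' _
  coefficients-cong q≈q' 1F = +-cong (+-cong (q≈q' _) (-‿cong (q≈q' _))) (-‿cong (q≈q' _))
  coefficients-cong q≈q' 2F = +-cong (+-cong (q≈q' _) (-‿cong (q≈q' _))) (-‿cong (q≈q' _))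
  coefficients-cong q≈q' 3F = q≈q' _
  coefficients-cong q≈q' 4F = +-cong (+-cong (q≈q' _) (-‿cong (q≈q' _))) (-‿cong (q≈q' _))
  coefficients-cong q≈q' 5F = q≈q' _

  module _ (1+1≈0 : 1# + 1# ≈ 0#) where
    open Char2Solver cring 1+1≈0

    private
      module P {n} = Forms (_:+_ {n}) _:*_

      𝟘 𝟙 : ∀ {n} → Polynomial n
      𝟘 = con false
      𝟙 = con true

    x+y≈0⇒x≈y : ∀ {x y} → x + y ≈ 0# → x ≈ y
    x+y≈0⇒x≈y {x} {y} x+y≈0 = begin
      x          ≈⟨ solve 2 (λ x y → x := x :+ y :+ y) refl x y ⟩
      x + y + y  ≈⟨ +-congʳ x+y≈0 ⟩
      0# + y     ≈⟨ +-identityˡ y ⟩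
      y          ∎

    *-square-scale : ∀ μ a b → (μ * a) * (μ * b) ≈ (μ * μ) * (a * b)
    *-square-scale = solve 3 (λ μ a b → (μ :* a) :* (μ :* b) := (μ :* μ) :* (a :* b)) refl

    quad-⊗ : ∀ l m x → quad (l ⊗ m) x ≈ (l · x) * (m · x)
    quad-⊗ l m x = solve 9 (λ l₀ l₁ l₂ m₀ m₁ m₂ x₀ x₁ x₂ →
      let l = l₀ ∷ l₁ ∷ l₂ ∷ [] ; m = m₀ ∷ m₁ ∷ m₂ ∷ [] ; x = x₀ ∷ x₁ ∷ x₂ ∷ []
      in P.quad (l P.⊗ m) x := (l P.· x) :* (m P.· x))
      refl (l 0F) (l 1F) (l 2F) (m 0F) (m 1F) (m 2F) (x 0F) (x 1F) (x 2F)

    quad-• : ∀ s c x → quad (s • c) x ≈ s * quad c x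
    quad-• s c x = solve 10 (λ s c₀ c₁ c₂ c₃ c₄ c₅ x₀ x₁ x₂ →
      let c = c₀ ∷ c₁ ∷ c₂ ∷ c₃ ∷ c₄ ∷ c₅ ∷ [] ; x = x₀ ∷ x₁ ∷ x₂ ∷ []
      in P.quad (s P.• c) x := s :* P.quad c x)
      refl s (c 0F) (c 1F) (c 2F) (c 3F) (c 4F) (c 5F) (x 0F) (x 1F) (x 2F)

    quad-+ᵥ : ∀ c x y → quad c (x +ᵥ y) ≈ quad c x + quad c y + polar c x y
    quad-+ᵥ c x y = solve 12 (λ c₀ c₁ c₂ c₃ c₄ c₅ x₀ x₁ x₂ y₀ y₁ y₂ →
      let c = c₀ ∷ c₁ ∷ c₂ ∷ c₃ ∷ c₄ ∷ c₅ ∷ [] ; x = x₀ ∷ x₁ ∷ x₂ ∷ [] ; y = y₀ ∷ y₁ ∷ y₂ ∷ []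
      in P.quad c (x P.+ᵥ y) := P.quad c x :+ P.quad c y :+ P.polar c x y)
      refl (c 0F) (c 1F) (c 2F) (c 3F) (c 4F) (c 5F) (x 0F) (x 1F) (x 2F) (y 0F) (y 1F) (y 2F)

    -- Cramer's rule k x = ((r ⨯ e) · x) p + ((e ⨯ p) · x) r + ((p ⨯ r) · x) e, expanded under quad c.
    quad-in-frame : ∀ c p r e x →
      let k = e · (p ⨯ r)
          M = quad c e • (p ⨯ r) +ᵥ polar c p e • (r ⨯ e) +ᵥ polar c r e • (e ⨯ p)
      in (k * k) * quad c x ≈ ((r ⨯ e) · x) * ((r ⨯ e) · x) * quad c p
                            + ((e ⨯ p) · x) * ((e ⨯ p) · x) * quad c r
                            + ((r ⨯ e) · x) * ((e ⨯ p) · x) * polar c p r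
                            + ((p ⨯ r) · x) * (M · x)
    quad-in-frame c p r e x = solve 18 (λ c₀ c₁ c₂ c₃ c₄ c₅ p₀ p₁ p₂ r₀ r₁ r₂ e₀ e₁ e₂ x₀ x₁ x₂ →
      let c = c₀ ∷ c₁ ∷ c₂ ∷ c₃ ∷ c₄ ∷ c₅ ∷ []
          p = p₀ ∷ p₁ ∷ p₂ ∷ [] ; r = r₀ ∷ r₁ ∷ r₂ ∷ [] ; e = e₀ ∷ e₁ ∷ e₂ ∷ [] ; x = x₀ ∷ x₁ ∷ x₂ ∷ []
          k = e P.· (p P.⨯ r)
          M = P.quad c e P.• (p P.⨯ r) P.+ᵥ P.polar c p e P.• (r P.⨯ e) P.+ᵥ P.polar c r e P.• (e P.⨯ p)
      in (k :* k) :* P.quad c x := ((r P.⨯ e) P.· x) :* ((r P.⨯ e) P.· x) :* P.quad c p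
                                 :+ ((e P.⨯ p) P.· x) :* ((e P.⨯ p) P.· x) :* P.quad c r
                                 :+ ((r P.⨯ e) P.· x) :* ((e P.⨯ p) P.· x) :* P.polar c p r
                                 :+ ((p P.⨯ r) P.· x) :* (M P.· x))
      refl (c 0F) (c 1F) (c 2F) (c 3F) (c 4F) (c 5F) (p 0F) (p 1F) (p 2F)
           (r 0F) (r 1F) (r 2F) (e 0F) (e 1F) (e 2F) (x 0F) (x 1F) (x 2F)

    Δ-shift : ∀ b s L → Δ (b +ᵥ s • (L ⊗ L)) ≈ Δ b + s * ((L · nucleus b) * (L · nucleus b))
    Δ-shift b s L = solve 10 (λ b₀ b₁ b₂ b₃ b₄ b₅ s l₀ l₁ l₂ →
      let b = b₀ ∷ b₁ ∷ b₂ ∷ b₃ ∷ b₄ ∷ b₅ ∷ [] ; L = l₀ ∷ l₁ ∷ l₂ ∷ []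
      in P.Δ (b P.+ᵥ s P.• (L P.⊗ L)) := P.Δ b :+ s :* ((L P.· P.nucleus b) :* (L P.· P.nucleus b)))
      refl (b 0F) (b 1F) (b 2F) (b 3F) (b 4F) (b 5F) s (L 0F) (L 1F) (L 2F)

    ·-+ᵥ : ∀ L x y → L · (x +ᵥ y) ≈ L · x + L · y
    ·-+ᵥ L x y = solve 9 (λ l₀ l₁ l₂ x₀ x₁ x₂ y₀ y₁ y₂ →
      let L = l₀ ∷ l₁ ∷ l₂ ∷ [] ; x = x₀ ∷ x₁ ∷ x₂ ∷ [] ; y = y₀ ∷ y₁ ∷ y₂ ∷ []
      in L P.· (x P.+ᵥ y) := L P.· x :+ L P.· y)
      refl (L 0F) (L 1F) (L 2F) (x 0F) (x 1F) (x 2F) (y 0F) (y 1F) (y 2F)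

    •-· : ∀ s x y → (s • x) · y ≈ s * (x · y)
    •-· s x y = solve 7 (λ s x₀ x₁ x₂ y₀ y₁ y₂ →
      let x = x₀ ∷ x₁ ∷ x₂ ∷ [] ; y = y₀ ∷ y₁ ∷ y₂ ∷ [] in (s P.• x) P.· y := s :* (x P.· y))
      refl s (x 0F) (x 1F) (x 2F) (y 0F) (y 1F) (y 2F)

    ·-• : ∀ x s y → x · (s • y) ≈ s * (y · x)
    ·-• x s y = solve 7 (λ x₀ x₁ x₂ s y₀ y₁ y₂ →
      let x = x₀ ∷ x₁ ∷ x₂ ∷ [] ; y = y₀ ∷ y₁ ∷ y₂ ∷ [] in x P.· (s P.• y) := s :* (y P.· x))
      refl (x 0F) (x 1F) (x 2F) s (y 0F) (y 1F) (y 2F)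

    ·-zeroˡ : ∀ {x} y → (∀ i → x i ≈ 0#) → x · y ≈ 0#
    ·-zeroˡ y x≈0 = trans (·-cong {y = y} x≈0 (λ _ → refl))
      (solve 3 (λ y₀ y₁ y₂ → (𝟘 ∷ 𝟘 ∷ 𝟘 ∷ []) P.· (y₀ ∷ y₁ ∷ y₂ ∷ []) := 𝟘) refl (y 0F) (y 1F) (y 2F))

    ·-⨯-self : ∀ x y → y · (x ⨯ y) ≈ 0#
    ·-⨯-self x y = solve 6 (λ x₀ x₁ x₂ y₀ y₁ y₂ →
      let x = x₀ ∷ x₁ ∷ x₂ ∷ [] ; y = y₀ ∷ y₁ ∷ y₂ ∷ [] in y P.· (x P.⨯ y) := 𝟘)
      refl (x 0F) (x 1F) (x 2F) (y 0F) (y 1F) (y 2F)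

    unit-· : ∀ x j → unit j · x ≈ x j
    unit-· x 0F =
      solve 3 (λ x₀ x₁ x₂ → (𝟙 ∷ 𝟘 ∷ 𝟘 ∷ []) P.· (x₀ ∷ x₁ ∷ x₂ ∷ []) := x₀) refl (x 0F) (x 1F) (x 2F)
    unit-· x 1F =
      solve 3 (λ x₀ x₁ x₂ → (𝟘 ∷ 𝟙 ∷ 𝟘 ∷ []) P.· (x₀ ∷ x₁ ∷ x₂ ∷ []) := x₁) refl (x 0F) (x 1F) (x 2F)
    unit-· x 2F =
      solve 3 (λ x₀ x₁ x₂ → (𝟘 ∷ 𝟘 ∷ 𝟙 ∷ []) P.· (x₀ ∷ x₁ ∷ x₂ ∷ []) := x₂) refl (x 0F) (x 1F) (x 2F)

    ·-ext : ∀ {v v'} → (∀ t → t · v ≈ t · v') → ∀ k → v k ≈ v' k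
    ·-ext {v} {v'} t·v≈t·v' k = trans (sym (unit-· v k)) (trans (t·v≈t·v' (unit k)) (unit-· v' k))

    ⨯-⨯ : ∀ u w L k → ((u ⨯ w) ⨯ L) k ≈ (L · w) * u k + (L · u) * w k
    ⨯-⨯ u w L = ·-ext λ t → solve 12 (λ t₀ t₁ t₂ u₀ u₁ u₂ w₀ w₁ w₂ l₀ l₁ l₂ →
      let t = t₀ ∷ t₁ ∷ t₂ ∷ [] ; u = u₀ ∷ u₁ ∷ u₂ ∷ [] ; w = w₀ ∷ w₁ ∷ w₂ ∷ [] ; L = l₀ ∷ l₁ ∷ l₂ ∷ []
      in t P.· ((u P.⨯ w) P.⨯ L) := t P.· ((L P.· w) P.• u P.+ᵥ (L P.· u) P.• w))
      refl (t 0F) (t 1F) (t 2F) (u 0F) (u 1F) (u 2F) (w 0F) (w 1F) (w 2F) (L 0F) (L 1F) (L 2F)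

    ⨯-+ᵥ-selfˡ : ∀ x y k → ((x +ᵥ y) ⨯ x) k ≈ (x ⨯ y) k
    ⨯-+ᵥ-selfˡ x y = ·-ext λ t → solve 9 (λ t₀ t₁ t₂ x₀ x₁ x₂ y₀ y₁ y₂ →
      let t = t₀ ∷ t₁ ∷ t₂ ∷ [] ; x = x₀ ∷ x₁ ∷ x₂ ∷ [] ; y = y₀ ∷ y₁ ∷ y₂ ∷ []
      in t P.· ((x P.+ᵥ y) P.⨯ x) := t P.· (x P.⨯ y))
      refl (t 0F) (t 1F) (t 2F) (x 0F) (x 1F) (x 2F) (y 0F) (y 1F) (y 2F)

    ⨯-+ᵥ-selfʳ : ∀ x y k → ((x +ᵥ y) ⨯ y) k ≈ (x ⨯ y) k
    ⨯-+ᵥ-selfʳ x y = ·-ext λ t → solve 9 (λ t₀ t₁ t₂ x₀ x₁ x₂ y₀ y₁ y₂ →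
      let t = t₀ ∷ t₁ ∷ t₂ ∷ [] ; x = x₀ ∷ x₁ ∷ x₂ ∷ [] ; y = y₀ ∷ y₁ ∷ y₂ ∷ []
      in t P.· ((x P.+ᵥ y) P.⨯ y) := t P.· (x P.⨯ y))
      refl (t 0F) (t 1F) (t 2F) (x 0F) (x 1F) (x 2F) (y 0F) (y 1F) (y 2F)

    ⨯-•-• : ∀ μ ν y k → ((μ • y) ⨯ (ν • y)) k ≈ 0#
    ⨯-•-• μ ν y = ·-ext λ t → solve 8 (λ t₀ t₁ t₂ μ ν y₀ y₁ y₂ →
      let t = t₀ ∷ t₁ ∷ t₂ ∷ [] ; y = y₀ ∷ y₁ ∷ y₂ ∷ []
      in t P.· ((μ P.• y) P.⨯ (ν P.• y)) := t P.· (𝟘 ∷ 𝟘 ∷ 𝟘 ∷ []))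
      refl (t 0F) (t 1F) (t 2F) μ ν (y 0F) (y 1F) (y 2F)

    coefficients-quad : ∀ c i → coefficients (quad c) i ≈ c i
    coefficients-quad c 0F = solve 6 (λ c₀ c₁ c₂ c₃ c₄ c₅ →
      let c = c₀ ∷ c₁ ∷ c₂ ∷ c₃ ∷ c₄ ∷ c₅ ∷ [] in P.quad c (𝟙 ∷ 𝟘 ∷ 𝟘 ∷ []) := c₀)
      refl (c 0F) (c 1F) (c 2F) (c 3F) (c 4F) (c 5F)
    coefficients-quad c 1F = solve 6 (λ c₀ c₁ c₂ c₃ c₄ c₅ →
      let c = c₀ ∷ c₁ ∷ c₂ ∷ c₃ ∷ c₄ ∷ c₅ ∷ [] in
      P.quad c (𝟙 ∷ 𝟙 ∷ 𝟘 ∷ []) :- P.quad c (𝟙 ∷ 𝟘 ∷ 𝟘 ∷ []) :- P.quad c (𝟘 ∷ 𝟙 ∷ 𝟘 ∷ []) := c₁)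
      refl (c 0F) (c 1F) (c 2F) (c 3F) (c 4F) (c 5F)
    coefficients-quad c 2F = solve 6 (λ c₀ c₁ c₂ c₃ c₄ c₅ →
      let c = c₀ ∷ c₁ ∷ c₂ ∷ c₃ ∷ c₄ ∷ c₅ ∷ [] in
      P.quad c (𝟙 ∷ 𝟘 ∷ 𝟙 ∷ []) :- P.quad c (𝟙 ∷ 𝟘 ∷ 𝟘 ∷ []) :- P.quad c (𝟘 ∷ 𝟘 ∷ 𝟙 ∷ []) := c₂)
      refl (c 0F) (c 1F) (c 2F) (c 3F) (c 4F) (c 5F)
    coefficients-quad c 3F = solve 6 (λ c₀ c₁ c₂ c₃ c₄ c₅ →
      let c = c₀ ∷ c₁ ∷ c₂ ∷ c₃ ∷ c₄ ∷ c₅ ∷ [] in P.quad c (𝟘 ∷ 𝟙 ∷ 𝟘 ∷ []) := c₃)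
      refl (c 0F) (c 1F) (c 2F) (c 3F) (c 4F) (c 5F)
    coefficients-quad c 4F = solve 6 (λ c₀ c₁ c₂ c₃ c₄ c₅ →
      let c = c₀ ∷ c₁ ∷ c₂ ∷ c₃ ∷ c₄ ∷ c₅ ∷ [] in
      P.quad c (𝟘 ∷ 𝟙 ∷ 𝟙 ∷ []) :- P.quad c (𝟘 ∷ 𝟙 ∷ 𝟘 ∷ []) :- P.quad c (𝟘 ∷ 𝟘 ∷ 𝟙 ∷ []) := c₄)
      refl (c 0F) (c 1F) (c 2F) (c 3F) (c 4F) (c 5F)
    coefficients-quad c 5F = solve 6 (λ c₀ c₁ c₂ c₃ c₄ c₅ →
      let c = c₀ ∷ c₁ ∷ c₂ ∷ c₃ ∷ c₄ ∷ c₅ ∷ [] in P.quad c (𝟘 ∷ 𝟘 ∷ 𝟙 ∷ []) := c₅)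
      refl (c 0F) (c 1F) (c 2F) (c 3F) (c 4F) (c 5F)

    quad-injective : ∀ {c d} → (∀ x → quad c x ≈ quad d x) → ∀ i → c i ≈ d i
    quad-injective {c} {d} c≗d i = begin
      c i                      ≈⟨ coefficients-quad c i ⟨
      coefficients (quad c) i  ≈⟨ coefficients-cong c≗d i ⟩
      coefficients (quad d) i  ≈⟨ coefficients-quad d i ⟩
      d i                      ∎

    -- Points of the Veronese surface

    ⨯≈0⇒minors-equal : ∀ {x y} → (∀ k → (x ⨯ y) k ≈ 0#) → ∀ i j → x i * y j ≈ x j * y i
    ⨯≈0⇒minors-equal x⨯y≈0 0F 0F = refl
    ⨯≈0⇒minors-equal x⨯y≈0 0F 1F = x+y≈0⇒x≈y (x⨯y≈0 2F)
    ⨯≈0⇒minors-equal x⨯y≈0 0F 2F = sym (x+y≈0⇒x≈y (x⨯y≈0 1F))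
    ⨯≈0⇒minors-equal x⨯y≈0 1F 0F = sym (x+y≈0⇒x≈y (x⨯y≈0 2F))
    ⨯≈0⇒minors-equal x⨯y≈0 1F 1F = refl
    ⨯≈0⇒minors-equal x⨯y≈0 1F 2F = x+y≈0⇒x≈y (x⨯y≈0 0F)
    ⨯≈0⇒minors-equal x⨯y≈0 2F 0F = x+y≈0⇒x≈y (x⨯y≈0 1F)
    ⨯≈0⇒minors-equal x⨯y≈0 2F 1F = sym (x+y≈0⇒x≈y (x⨯y≈0 0F))
    ⨯≈0⇒minors-equal x⨯y≈0 2F 2F = refl

    ⨯≈0⇒multiple : ∀ {x y} → NonZero y → (∀ k → (x ⨯ y) k ≈ 0#) → ∃ λ μ → ∀ i → x i ≈ μ * y i
    ⨯≈0⇒multiple {x} {y} y≉0 x⨯y≈0 with nonzero-entry y≉0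
    ... | i , yᵢ≉0 = inv yᵢ≉0 * x i , λ j → begin
      x j                     ≈⟨ inv-cancelˡ yᵢ≉0 (x j) ⟨
      inv yᵢ≉0 * (y i * x j)  ≈⟨ *-congˡ (trans (*-comm (y i) (x j)) (⨯≈0⇒minors-equal x⨯y≈0 j i)) ⟩
      inv yᵢ≉0 * (x i * y j)  ≈⟨ *-assoc _ (x i) (y j) ⟨
      inv yᵢ≉0 * x i * y j    ∎

    ⨯-common-factor : ∀ {x y z} → NonZero z → (∀ k → (x ⨯ z) k ≈ 0#) → (∀ k → (y ⨯ z) k ≈ 0#) →
                      ∀ k → (x ⨯ y) k ≈ 0#
    ⨯-common-factor z≉0 x⨯z≈0 y⨯z≈0 k =
      let μ , x≈μz = ⨯≈0⇒multiple z≉0 x⨯z≈0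
          ν , y≈νz = ⨯≈0⇒multiple z≉0 y⨯z≈0
      in trans (⨯-cong x≈μz y≈νz k) (⨯-•-• μ ν _ k)

    ver-• : ∀ {x y μ} → (∀ i → y i ≈ μ * x i) → ∀ k → ver y k ≈ (μ * μ) * ver x k
    ver-• y≈μx 0F = trans (*-cong (y≈μx 0F) (y≈μx 0F)) (*-square-scale _ _ _)
    ver-• y≈μx 1F = trans (*-cong (y≈μx 0F) (y≈μx 1F)) (*-square-scale _ _ _)
    ver-• y≈μx 2F = trans (*-cong (y≈μx 0F) (y≈μx 2F)) (*-square-scale _ _ _)
    ver-• y≈μx 3F = trans (*-cong (y≈μx 1F) (y≈μx 1F)) (*-square-scale _ _ _)
    ver-• y≈μx 4F = trans (*-cong (y≈μx 1F) (y≈μx 2F)) (*-square-scale _ _ _)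
    ver-• y≈μx 5F = trans (*-cong (y≈μx 2F) (y≈μx 2F)) (*-square-scale _ _ _)

    multiple⇒ver-∼ : ∀ {x y μ} → NonZero y → (∀ i → y i ≈ μ * x i) → ver x ∼ ver y
    multiple⇒ver-∼ {μ = μ} y≉0 y≈μx = μ * μ , x*y≉0 μ≉0 μ≉0 , ver-• y≈μx
      where
      μ≉0 : ¬ μ ≈ 0#
      μ≉0 μ≈0 = y≉0 (λ i → trans (y≈μx i) (x≈0⇒x*y≈0 _ μ≈0))

    square-minor≈0 : ∀ {t a b c d} → c * c ≈ t * (a * a) → d * d ≈ t * (b * b) → a * d + b * c ≈ 0#
    square-minor≈0 {t} {a} {b} {c} {d} c²≈ta² d²≈tb² = x*x≈0⇒x≈0 (begin
      (a * d + b * c) * (a * d + b * c)                  ≈⟨ frobenius ⟩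
      (a * a) * (d * d) + (b * b) * (c * c)              ≈⟨ +-cong (*-congˡ d²≈tb²) (*-congˡ c²≈ta²) ⟩
      (a * a) * (t * (b * b)) + (b * b) * (t * (a * a))  ≈⟨ doubled ⟩
      0#                                                 ∎)
      where
      frobenius : (a * d + b * c) * (a * d + b * c) ≈ (a * a) * (d * d) + (b * b) * (c * c)
      frobenius = solve 4 (λ a b c d →
        (a :* d :+ b :* c) :* (a :* d :+ b :* c) := (a :* a) :* (d :* d) :+ (b :* b) :* (c :* c))
        refl a b c d
      doubled : (a * a) * (t * (b * b)) + (b * b) * (t * (a * a)) ≈ 0#
      doubled = solve 3 (λ t A B → A :* (t :* B) :+ B :* (t :* A) := 𝟘) refl t (a * a) (b * b)

    ver-∼⇒⨯≈0 : ∀ {x y} → ver x ∼ ver y → ∀ k → (x ⨯ y) k ≈ 0#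
    ver-∼⇒⨯≈0 (_ , _ , y≈λx) 0F = square-minor≈0 (y≈λx 3F) (y≈λx 5F)
    ver-∼⇒⨯≈0 (_ , _ , y≈λx) 1F = square-minor≈0 (y≈λx 5F) (y≈λx 0F)
    ver-∼⇒⨯≈0 (_ , _ , y≈λx) 2F = square-minor≈0 (y≈λx 0F) (y≈λx 3F)

    ver-≁⇒⨯≉0 : ∀ {u w} → NonZero u → NonZero w → ¬ ver u ∼ ver w → NonZero (w ⨯ u)
    ver-≁⇒⨯≉0 u≉0 w≉0 u≁w w⨯u≈0 = u≁w (multiple⇒ver-∼ w≉0 (proj₂ (⨯≈0⇒multiple u≉0 w⨯u≈0)))

    -- Degenerate conics

    conic-through-line : ∀ {c p r} → quad c p ≈ 0# → quad c r ≈ 0# → polar c p r ≈ 0# → NonZero (p ⨯ r) →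
                         ∃ λ M → ∀ i → c i ≈ ((p ⨯ r) ⊗ M) i
    conic-through-line {c} {p} {r} cp≈0 cr≈0 cpr≈0 ℓ≉0 with nonzero-entry ℓ≉0
    ... | j , ℓⱼ≉0 = inv k²≉0 • M , quad-injective values
      where
      e : Vec 3
      e = unit j
      k : Carrier
      k = e · (p ⨯ r)
      k²≉0 : ¬ k * k ≈ 0#
      k²≉0 = x*y≉0 k≉0 k≉0
        where
        k≉0 : ¬ k ≈ 0#
        k≉0 = ℓⱼ≉0 ∘ trans (sym (unit-· (p ⨯ r) j))
      M : Vec 3
      M = quad c e • (p ⨯ r) +ᵥ polar c p e • (r ⨯ e) +ᵥ polar c r e • (e ⨯ p)
      values : ∀ x → quad c x ≈ quad ((p ⨯ r) ⊗ (inv k²≉0 • M)) x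
      values x = begin
        quad c x                                    ≈⟨ inv-cancelˡ k²≉0 (quad c x) ⟨
        inv k²≉0 * ((k * k) * quad c x)             ≈⟨ *-congˡ (quad-in-frame c p r e x) ⟩
        inv k²≉0 * (A * A * quad c p + C * C * quad c r + A * C * polar c p r + l * (M · x))
          ≈⟨ *-congˡ (trans (+-congʳ off-line≈0) (+-identityˡ _)) ⟩
        inv k²≉0 * (l * (M · x))                    ≈⟨ x∙yz≈y∙xz _ l _ ⟩
        l * (inv k²≉0 * (M · x))                    ≈⟨ *-congˡ (•-· (inv k²≉0) M x) ⟨
        l * ((inv k²≉0 • M) · x)                    ≈⟨ quad-⊗ (p ⨯ r) (inv k²≉0 • M) x ⟨
        quad ((p ⨯ r) ⊗ (inv k²≉0 • M)) x           ∎
        where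
        A C l : Carrier
        A = (r ⨯ e) · x
        C = (e ⨯ p) · x
        l = (p ⨯ r) · x
        off-line≈0 : A * A * quad c p + C * C * quad c r + A * C * polar c p r ≈ 0#
        off-line≈0 = trans (+-cong (+-cong (y≈0⇒x*y≈0 _ cp≈0) (y≈0⇒x*y≈0 _ cr≈0)) (y≈0⇒x*y≈0 _ cpr≈0))
                           (trans (+-congʳ (+-identityʳ 0#)) (+-identityʳ 0#))

    line-product⇒line-pair : ∀ {c ℓ M} → NonZero c → NonZero ℓ → (∀ i → c i ≈ (ℓ ⊗ M) i) →
                             ¬ IsDoubleLine c → IsRealLinePair c
    line-product⇒line-pair {c} {ℓ} {M} c≉0 ℓ≉0 c≈ℓM not-double = ℓ , M , ℓ≉0 , M≉0 , ℓ≁M , c≈ℓM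
      where
      M≉0 : NonZero M
      M≉0 M≈0 = c≉0 λ i → begin
        c i               ≈⟨ c≈ℓM i ⟩
        (ℓ ⊗ M) i         ≈⟨ ⊗-congʳ ℓ (λ j → trans (M≈0 j) (sym (zeroˡ (M j)))) i ⟩
        (ℓ ⊗ (0# • M)) i  ≈⟨ ⊗-•ʳ 0# ℓ M i ⟩
        0# * (ℓ ⊗ M) i    ≈⟨ zeroˡ _ ⟩
        0#                ∎
      ℓ≁M : ¬ ℓ ∼ M
      ℓ≁M (λ' , λ'≉0 , M≈λ'ℓ) = not-double (λ' , ℓ , λ'≉0 , ℓ≉0 ,
        λ i → trans (c≈ℓM i) (trans (⊗-congʳ ℓ M≈λ'ℓ i) (⊗-•ʳ λ' ℓ ℓ i)))

    two-zeros-on-line⇒line-pair : ∀ {c p r} → NonZero c → quad c p ≈ 0# → quad c r ≈ 0# →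
                                  polar c p r ≈ 0# → NonZero (p ⨯ r) → ¬ IsDoubleLine c → IsRealLinePair c
    two-zeros-on-line⇒line-pair c≉0 cp≈0 cr≈0 cpr≈0 p⨯r≉0 =
      line-product⇒line-pair c≉0 p⨯r≉0 (proj₂ (conic-through-line cp≈0 cr≈0 cpr≈0 p⨯r≉0))

    degenerate-through-two-points⇒line-pair :
      ∀ {c u w} → NonZero c → Δ c ≈ 0# → quad c u ≈ 0# → quad c w ≈ 0# → NonZero (w ⨯ u) →
      ¬ IsDoubleLine c → IsRealLinePair c
    degenerate-through-two-points⇒line-pair {c} {u} {w} c≉0 Δ≈0 cu≈0 cw≈0 w⨯u≉0
      with all-zero? (nucleus c) | all-zero? (u ⨯ nucleus c) | all-zero? (w ⨯ nucleus c)
    ... | yes N≈0 | _ | _ =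
      two-zeros-on-line⇒line-pair c≉0 cw≈0 cu≈0 (·-zeroˡ (w ⨯ u) N≈0) w⨯u≉0
    ... | no _ | no u⨯N≉0 | _ =
      two-zeros-on-line⇒line-pair c≉0 cu≈0 Δ≈0 (·-⨯-self u (nucleus c)) u⨯N≉0
    ... | no _ | yes _ | no w⨯N≉0 =
      two-zeros-on-line⇒line-pair c≉0 cw≈0 Δ≈0 (·-⨯-self w (nucleus c)) w⨯N≉0
    ... | no N≉0 | yes u⨯N≈0 | yes w⨯N≈0 = ⊥-elim (w⨯u≉0 (⨯-common-factor N≉0 w⨯N≈0 u⨯N≈0))

    -- The quadratic extension

    module QuadraticExtension (β γ : Carrier) where
      open Ext β γ public using (E; prodE) renaming (_⊕_ to _+ᴱ_; _⊗_ to _*ᴱ_)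
      open Forms _+ᴱ_ _*ᴱ_ public using () renaming (Δ to Δᴱ)

      _≈ᴱ_ : E → E → Set
      (x , y) ≈ᴱ (x' , y') = x ≈ x' × y ≈ y'

      ι : Carrier → E
      ι x = x , 0#

      +ᴱ-cong : ∀ {x x' y y'} → x ≈ᴱ x' → y ≈ᴱ y' → (x +ᴱ y) ≈ᴱ (x' +ᴱ y')
      +ᴱ-cong (x₁≈ , x₂≈) (y₁≈ , y₂≈) = +-cong x₁≈ y₁≈ , +-cong x₂≈ y₂≈

      *ᴱ-cong : ∀ {x x' y y'} → x ≈ᴱ x' → y ≈ᴱ y' → (x *ᴱ y) ≈ᴱ (x' *ᴱ y')
      *ᴱ-cong (x₁≈ , x₂≈) (y₁≈ , y₂≈) =
        +-cong (*-cong x₁≈ y₁≈) (-‿cong (*-congˡ (*-cong x₂≈ y₂≈))) ,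
        +-cong (+-cong (*-cong x₁≈ y₂≈) (*-cong x₂≈ y₁≈)) (-‿cong (*-congˡ (*-cong x₂≈ y₂≈)))

      open FormsCong _≈ᴱ_ _+ᴱ_ _*ᴱ_ +ᴱ-cong *ᴱ-cong public using () renaming (Δ-cong to Δᴱ-cong)

      -- The operations of Ext β γ on polynomial syntax, so that the solver can normalise
      -- each component of an expression in E.
      private
        module Eₚ {n} (b g : Polynomial n) where
          _+ₚ_ _*ₚ_ : Polynomial n × Polynomial n → Polynomial n × Polynomial n → Polynomial n × Polynomial n
          (x , y) +ₚ (x' , y') = x :+ x' , y :+ y'
          (x , y) *ₚ (x' , y') = x :* x' :- g :* (y :* y') , x :* y' :+ y :* x' :- b :* (y :* y')
          open Forms _+ₚ_ _*ₚ_ public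

      Δᴱ-prodE : ∀ l m → Δᴱ (prodE l m) ≈ᴱ ι 0#
      Δᴱ-prodE l m =
        solve 14 (λ b g l₀ l₀' l₁ l₁' l₂ l₂' m₀ m₀' m₁ m₁' m₂ m₂' →
          let l = (l₀ , l₀') ∷ (l₁ , l₁') ∷ (l₂ , l₂') ∷ [] ; m = (m₀ , m₀') ∷ (m₁ , m₁') ∷ (m₂ , m₂') ∷ []
          in proj₁ (Eₚ.Δ b g (Eₚ._⊗_ b g l m)) := 𝟘)
          refl β γ (proj₁ (l 0F)) (proj₂ (l 0F)) (proj₁ (l 1F)) (proj₂ (l 1F)) (proj₁ (l 2F)) (proj₂ (l 2F))
                   (proj₁ (m 0F)) (proj₂ (m 0F)) (proj₁ (m 1F)) (proj₂ (m 1F)) (proj₁ (m 2F)) (proj₂ (m 2F)) ,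
        solve 14 (λ b g l₀ l₀' l₁ l₁' l₂ l₂' m₀ m₀' m₁ m₁' m₂ m₂' →
          let l = (l₀ , l₀') ∷ (l₁ , l₁') ∷ (l₂ , l₂') ∷ [] ; m = (m₀ , m₀') ∷ (m₁ , m₁') ∷ (m₂ , m₂') ∷ []
          in proj₂ (Eₚ.Δ b g (Eₚ._⊗_ b g l m)) := 𝟘)
          refl β γ (proj₁ (l 0F)) (proj₂ (l 0F)) (proj₁ (l 1F)) (proj₂ (l 1F)) (proj₁ (l 2F)) (proj₂ (l 2F))
                   (proj₁ (m 0F)) (proj₂ (m 0F)) (proj₁ (m 1F)) (proj₂ (m 1F)) (proj₁ (m 2F)) (proj₂ (m 2F))

      Δᴱ-ι : ∀ c → Δᴱ (ι ∘ c) ≈ᴱ ι (Δ c)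
      Δᴱ-ι c =
        solve 8 (λ b g c₀ c₁ c₂ c₃ c₄ c₅ →
          let c = c₀ ∷ c₁ ∷ c₂ ∷ c₃ ∷ c₄ ∷ c₅ ∷ []
          in proj₁ (Eₚ.Δ b g (λ i → c i , 𝟘)) := P.Δ c)
          refl β γ (c 0F) (c 1F) (c 2F) (c 3F) (c 4F) (c 5F) ,
        solve 8 (λ b g c₀ c₁ c₂ c₃ c₄ c₅ →
          let c = c₀ ∷ c₁ ∷ c₂ ∷ c₃ ∷ c₄ ∷ c₅ ∷ []
          in proj₂ (Eₚ.Δ b g (λ i → c i , 𝟘)) := 𝟘)
          refl β γ (c 0F) (c 1F) (c 2F) (c 3F) (c 4F) (c 5F)

    splits⇒Δ≈0 : ∀ {c} → SplitsOverFq² c → Δ c ≈ 0#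
    splits⇒Δ≈0 {c} (β , γ , _ , L , M , c≈LM) = begin
      Δ c                     ≈⟨ proj₁ (Δᴱ-ι c) ⟨
      proj₁ (Δᴱ (ι ∘ c))      ≈⟨ proj₁ (Δᴱ-cong c≈LM) ⟩
      proj₁ (Δᴱ (prodE L M))  ≈⟨ proj₁ (Δᴱ-prodE L M) ⟩
      0#                      ∎
      where open QuadraticExtension β γ

    a2i≡0 : ∀ S → MeetsVeroneseInTwoPoints S → A2i≡0 S
    a2i≡0 S (u , w , u≉0 , w≉0 , u∈S , w∈S , u≁w , _) c c≉0 c⊇S (splits , not-double , not-real) =
      not-real (degenerate-through-two-points⇒line-pair c≉0 (splits⇒Δ≈0 splits)
        (∈S⇒on-hyperplane S c c⊇S u∈S) (∈S⇒on-hyperplane S c c⊇S w∈S) (ver-≁⇒⨯≉0 u≉0 w≉0 u≁w) not-double)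

    module _ (S : Solid) (u w : Vec 3) (u∈S : ver u ∈S S) (w∈S : ver w ∈S S) (w⨯u≉0 : NonZero (w ⨯ u))
             (only-u-w : ∀ x → NonZero x → ver x ∈S S → ver x ∼ ver u ⊎ ver x ∼ ver w)
             (a : Vec 6) (s : Carrier) (L : Vec 3) (a≉0 : NonZero a) (a⊇S : Contains a S)
             (s≉0 : ¬ s ≈ 0#) (L≉0 : NonZero L) (a≈sL² : ∀ i → a i ≈ s * (L ⊗ L) i) where

      quad-double-line : ∀ x → quad a x ≈ s * ((L · x) * (L · x))
      quad-double-line x = begin
        quad a x                 ≈⟨ quad-cong {x = x} a≈sL² (λ _ → refl) ⟩
        quad (s • (L ⊗ L)) x     ≈⟨ quad-• s (L ⊗ L) x ⟩
        s * quad (L ⊗ L) x       ≈⟨ *-congˡ (quad-⊗ L L x) ⟩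
        s * ((L · x) * (L · x))  ∎

      L-vanishes : ∀ {x} → ver x ∈S S → L · x ≈ 0#
      L-vanishes {x} x∈S =
        x*x≈0⇒x≈0 (x*y≈0⇒y≈0 s≉0 (trans (sym (quad-double-line x)) (∈S⇒on-hyperplane S a a⊇S x∈S)))

      w+u≉0 : NonZero (w +ᵥ u)
      w+u≉0 w+u≈0 = w⨯u≉0 λ k → begin
        (w ⨯ u) k                ≈⟨ ⨯-+ᵥ-selfʳ w u k ⟨
        ((w +ᵥ u) ⨯ u) k
          ≈⟨ ⨯-cong (λ i → trans (w+u≈0 i) (sym (zeroˡ (u i)))) (λ i → sym (*-identityˡ (u i))) k ⟩
        ((0# • u) ⨯ (1# • u)) k  ≈⟨ ⨯-•-• 0# 1# u k ⟩
        0#                       ∎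

      no-third-point : ¬ (ver (w +ᵥ u) ∼ ver u ⊎ ver (w +ᵥ u) ∼ ver w)
      no-third-point (inj₁ w+u∼u) = w⨯u≉0 (λ k → trans (sym (⨯-+ᵥ-selfʳ w u k)) (ver-∼⇒⨯≈0 w+u∼u k))
      no-third-point (inj₂ w+u∼w) = w⨯u≉0 (λ k → trans (sym (⨯-+ᵥ-selfˡ w u k)) (ver-∼⇒⨯≈0 w+u∼w k))

      nucleus-off-line : ∀ {b j} → Contains b S → ¬ a j ≈ 0# → b j ≈ 0# → NonZero b → ¬ L · nucleus b ≈ 0#
      nucleus-off-line {b} b⊇S aⱼ≉0 bⱼ≈0 b≉0 κ≈0 =
        no-third-point (only-u-w (w +ᵥ u) w+u≉0
          (hyperplane-intersection⊆solid S a b a⊇S b⊇S aⱼ≉0 bⱼ≈0 b≉0 on-a on-b))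
        where
        on-a : quad a (w +ᵥ u) ≈ 0#
        on-a = begin
          quad a (w +ᵥ u)                        ≈⟨ quad-double-line (w +ᵥ u) ⟩
          s * ((L · (w +ᵥ u)) * (L · (w +ᵥ u)))  ≈⟨ y≈0⇒x*y≈0 s (y≈0⇒x*y≈0 _ L·w+u≈0) ⟩
          0#                                     ∎
          where
          L·w+u≈0 : L · (w +ᵥ u) ≈ 0#
          L·w+u≈0 = trans (·-+ᵥ L w u) (trans (+-cong (L-vanishes w∈S) (L-vanishes u∈S)) (+-identityʳ 0#))

        w⨯u∥L : ∃ λ μ → ∀ i → (w ⨯ u) i ≈ μ * L i
        w⨯u∥L = ⨯≈0⇒multiple L≉0 λ k → begin
          ((w ⨯ u) ⨯ L) k                ≈⟨ ⨯-⨯ w u L k ⟩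
          (L · u) * w k + (L · w) * u k
            ≈⟨ +-cong (x≈0⇒x*y≈0 _ (L-vanishes u∈S)) (x≈0⇒x*y≈0 _ (L-vanishes w∈S)) ⟩
          0# + 0#                        ≈⟨ +-identityʳ 0# ⟩
          0#                             ∎

        polar≈0 : polar b w u ≈ 0#
        polar≈0 = begin
          nucleus b · (w ⨯ u)                ≈⟨ ·-cong {x = nucleus b} (λ _ → refl) (proj₂ w⨯u∥L) ⟩
          nucleus b · (proj₁ w⨯u∥L • L)      ≈⟨ ·-• (nucleus b) (proj₁ w⨯u∥L) L ⟩
          proj₁ w⨯u∥L * (L · nucleus b)      ≈⟨ y≈0⇒x*y≈0 _ κ≈0 ⟩
          0#                                 ∎

        on-b : quad b (w +ᵥ u) ≈ 0#
        on-b = begin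
          quad b (w +ᵥ u)                    ≈⟨ quad-+ᵥ b w u ⟩
          quad b w + quad b u + polar b w u
            ≈⟨ +-cong (+-cong (∈S⇒on-hyperplane S b b⊇S w∈S) (∈S⇒on-hyperplane S b b⊇S u∈S)) polar≈0 ⟩
          0# + 0# + 0#                       ≈⟨ trans (+-congʳ (+-identityʳ 0#)) (+-identityʳ 0#) ⟩
          0#                                 ∎

      nonsingular-in-pencil : ∀ {b j} → Contains b S → ¬ a j ≈ 0# → b j ≈ 0# → NonZero b → A3>0 S
      nonsingular-in-pencil {b} {j} b⊇S aⱼ≉0 bⱼ≈0 b≉0 with Δ b ≟ 0#
      ... | no Δb≉0 = b , b≉0 , b⊇S , Δb≉0 ∘ splits⇒Δ≈0
      ... | yes Δb≈0 = b +ᵥ a , b+a≉0 , contains-+ S b a b⊇S a⊇S , Δ≉0 ∘ splits⇒Δ≈0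
        where
        κ : Carrier
        κ = L · nucleus b
        κ≉0 : ¬ κ ≈ 0#
        κ≉0 = nucleus-off-line b⊇S aⱼ≉0 bⱼ≈0 b≉0
        b+a≉0 : NonZero (b +ᵥ a)
        b+a≉0 b+a≈0 = aⱼ≉0 (trans (sym (trans (+-congʳ bⱼ≈0) (+-identityˡ (a j)))) (b+a≈0 j))
        Δ≉0 : ¬ Δ (b +ᵥ a) ≈ 0#
        Δ≉0 Δ≈0 = x*y≉0 s≉0 (x*y≉0 κ≉0 κ≉0) (begin
          s * (κ * κ)               ≈⟨ +-identityˡ _ ⟨
          0# + s * (κ * κ)          ≈⟨ +-congʳ Δb≈0 ⟨
          Δ b + s * (κ * κ)         ≈⟨ Δ-shift b s L ⟨
          Δ (b +ᵥ s • (L ⊗ L))      ≈⟨ Δ-cong {b +ᵥ a} (λ i → +-congˡ (a≈sL² i)) ⟨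
          Δ (b +ᵥ a)                ≈⟨ Δ≈0 ⟩
          0#                        ∎)

      a3>0 : A3>0 S
      a3>0 =
        let j , aⱼ≉0 = nonzero-entry a≉0
            b , b≉0 , bⱼ≈0 , b⊇S = hyperplane-through-solid S j
        in nonsingular-in-pencil b⊇S aⱼ≉0 bⱼ≈0 b≉0

lemma3p2 : (𝔽 : FiniteField) →
    2 < FiniteField.order 𝔽 →
    2 ∣ FiniteField.order 𝔽 →
    FiniteField._≈_ 𝔽 (FiniteField._+_ 𝔽 (FiniteField.1# 𝔽) (FiniteField.1# 𝔽)) (FiniteField.0# 𝔽) →
    (S : Geometry.Solid 𝔽) →
    Geometry.A1≡1 𝔽 S →
    Geometry.MeetsVeroneseInTwoPoints 𝔽 S →
    Geometry.A2i≡0 𝔽 S × Geometry.A3>0 𝔽 S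
lemma3p2 𝔽 _ _ 1+1≈0 S (a , a≉0 , a⊇S , (s , L , s≉0 , L≉0 , a≈sL²) , _)
         two@(u , w , u≉0 , w≉0 , u∈S , w∈S , u≁w , only-u-w) =
  a2i≡0 1+1≈0 S two ,
  a3>0 1+1≈0 S u w u∈S w∈S (ver-≁⇒⨯≉0 1+1≈0 u≉0 w≉0 u≁w) only-u-w a s L a≉0 a⊇S s≉0 L≉0 a≈sL²
  where open Conics 𝔽
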